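{- Let $\alpha$ be a composition of $n$, $E\in\mathcal E(\alpha)$, $T_0=T_{0,E}$ the source tableau of $E$, $f\in\operatorname{End}_{H_n(0)}(\mathbf S_{\alpha,E})$, and write $f(T_0)=\sum_{T\in E}a_TT$ with $a_T\in\mathbb C$. If $a_T\ne0$ then $D(T)\subseteq D(T_0)$.
   Context: $H_n(0)$ is the unital $\mathbb C$-algebra generated by $\pi_1,\dots,\pi_{n-1}$ with $\pi_i^2=\pi_i$, $\pi_i\pi_{i+1}\pi_i=\pi_{i+1}\pi_i\pi_{i+1}$, $\pi_i\pi_j=\pi_j\pi_i$ ($|i-j|\ge2$). A composition $\alpha=(\alpha_1,\dots,\alpha_l)$ of $n$ has diagram $\{(i,j):i\le l,j\le\alpha_i\}$ (matrix coordinates, row 1 on top). An SCT of shape $\alpha$ is a bijection $T$ from the diagram to $[n]$ with rows decreasing left to right, first column increasing top to bottom, and the triple rule: if $(j,k),(i,k-1)\in\alpha$, $j>i$, $T(j,k)<T(i,k-1)$, then $(i,k)\in\alpha$ and $T(j,k)<T(i,k)$. With $c_T(k)$ the column of $T^{ -1}(k)$ and cell $(i,j)$ attacking $(i',j')$ iff ($j=j'$, $i\ne i'$) or ($j=j'-1$, $i<i'$): $D(T)=\{i\in[n-1]:c_T(i)\le c_T(i+1)\}$, $AD(T)=\{i\in D(T):T^{ -1}(i)\text{ attacks }T^{ -1}(i+1)\}$, $nAD(T)=D(T)\setminus AD(T)$. $H_n(0)$ acts on $\operatorname{span}_{\mathbb C}$ of the SCTs of shape $\alpha$ by $\pi_iT=T$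 if $i\notin D(T)$, $0$ if $i\in AD(T)$, and $T$ with entries $i,i+1$ interchanged if $i\in nAD(T)$. $T_1\sim T_2$ iff in each column the relative orders of entries coincide; $\mathcal E(\alpha)$ is the set of classes and $\mathbf S_{\alpha,E}=\operatorname{span}_{\mathbb C}E$ is an $H_n(0)$-submodule. The source tableau $T_{0,E}$ is the unique $T\in E$ such that for every $i\in[n-1]$ with $c_T(i+1)<c_T(i)$, the cell of $i+1$ is immediately to the left of the cell of $i$ in the same row (it is known to exist and be unique). -}

module Defs where

open import Level using (Level; _⊔_)
open import Data.Nat using (ℕ; zero; suc; _<_; _≤_; _≤?_; _<?_; _≟_)
open import Data.Nat.Properties using () renaming (_≟_ to _≟ℕ_)
open import Data.Product using (Σ; ∃; ∃-syntax; _×_; _,_)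
open import Data.Nat.ListAction using (sum)
open import Data.List using (List; []; _∷_; map; length; concat; concatMap; upTo; _++_)
open import Data.List.Relation.Unary.All using (All)
open import Data.List.Relation.Binary.Permutation.Propositional using (_↭_)
import Data.List.Properties as LP
open import Data.Maybe using (Maybe; just; nothing)
import Data.Maybe as Maybe
open import Relation.Nullary using (¬_; Dec; yes; no)
open import Relation.Binary.PropositionalEquality using (_≡_)
open import Algebra.Bundles using (CommutativeRing)

-- Compositions and tableaux (rows indexed from 0 top to bottom,
-- columns indexed from 0 left to right; entries are naturals 1..n)

Composition : ℕ → List ℕ → Set
Composition n α = All (λ a → 0 < a) α × sum α ≡ n

Tab : Set
Tab = List (List ℕ)

at : {A : Set} → List A → ℕ → Maybe A
at []       _       = nothing
at (x ∷ xs) zero    = just x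
at (x ∷ xs) (suc i) = at xs i

entry : Tab → ℕ → ℕ → Maybe ℕ
entry T i j = Maybe._>>=_ (at T i) (λ row → at row j)

shape : Tab → List ℕ
shape = map length

range : ℕ → List ℕ
range n = map suc (upTo n)

record SCT (n : ℕ) (α : List ℕ) (T : Tab) : Set where
  field
    hasShape : shape T ≡ α
    bij      : concat T ↭ range n
    rowDec   : ∀ i j a b → entry T i j ≡ just a → entry T i (suc j) ≡ just b → b < a
    col1Inc  : ∀ i a b → entry T i 0 ≡ just a → entry T (suc i) 0 ≡ just b → a < b
    -- triple rule, with k = suc c (so column k-1 is c)
    triple   : ∀ i j c a b → i < j → entry T j (suc c) ≡ just a → entry T i c ≡ just b →
               a < b → ∃[ d ] (entry T i (suc c) ≡ just d × a < d)

findInRow : List ℕ → ℕ → Maybe ℕ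
findInRow []       k = nothing
findInRow (x ∷ xs) k with x ≟ℕ k
... | yes _ = just zero
... | no  _ = Maybe.map suc (findInRow xs k)

pos : Tab → ℕ → Maybe (ℕ × ℕ)
pos []           k = nothing
pos (row ∷ rows) k with findInRow row k
... | just c  = just (zero , c)
... | nothing = Maybe.map (λ { (r , c) → (suc r , c) }) (pos rows k)

Attacks : ℕ × ℕ → ℕ × ℕ → Set
Attacks (r , c) (r' , c') = (c ≡ c' × ¬ r ≡ r') Data.Sum.⊎ (suc c ≡ c' × r < r')
  where import Data.Sum

attacks? : ∀ p q → Dec (Attacks p q)
attacks? (r , c) (r' , c') with c ≟ℕ c' | r ≟ℕ r' | suc c ≟ℕ c' | r <? r'
... | yes e | no ne | _ | _ = yes (Data.Sum.inj₁ (e , ne))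
  where import Data.Sum
... | _ | _ | yes e | yes lt = yes (Data.Sum.inj₂ (e , lt))
  where import Data.Sum
... | yes e | yes eq | no ne | _ = no λ { (Data.Sum.inj₁ (_ , x)) → x eq ; (Data.Sum.inj₂ (x , _)) → ne x }
  where import Data.Sum
... | yes e | yes eq | yes _ | no nl = no λ { (Data.Sum.inj₁ (_ , x)) → x eq ; (Data.Sum.inj₂ (_ , y)) → nl y }
  where import Data.Sum
... | no ne | _ | no ne' | _ = no λ { (Data.Sum.inj₁ (x , _)) → ne x ; (Data.Sum.inj₂ (x , _)) → ne' x }
  where import Data.Sum
... | no ne | _ | yes _ | no nl = no λ { (Data.Sum.inj₁ (x , _)) → ne x ; (Data.Sum.inj₂ (_ , y)) → nl y }
  where import Data.Sum

Des : ℕ → Tab → ℕ → Set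
Des n T m = 1 ≤ m × m < n ×
  (∃[ r₁ ] ∃[ c₁ ] ∃[ r₂ ] ∃[ c₂ ]
     (pos T m ≡ just (r₁ , c₁) × pos T (suc m) ≡ just (r₂ , c₂) × c₁ ≤ c₂))

_∼_ : Tab → Tab → Set
T₁ ∼ T₂ = ∀ r r' c a b a' b' →
  entry T₁ r c ≡ just a → entry T₁ r' c ≡ just b →
  entry T₂ r c ≡ just a' → entry T₂ r' c ≡ just b' →
  (a < b → a' < b') × (a' < b' → a < b)

IsSource : ℕ → Tab → Set
IsSource n T = ∀ i → 1 ≤ i → i < n → ∀ r₁ c₁ r₂ c₂ →
  pos T i ≡ just (r₁ , c₁) → pos T (suc i) ≡ just (r₂ , c₂) → c₂ < c₁ →
  r₂ ≡ r₁ × suc c₂ ≡ c₁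

swapVal : ℕ → ℕ → ℕ
swapVal m x with x ≟ℕ m
... | yes _ = suc m
... | no _ with x ≟ℕ suc m
...   | yes _ = m
...   | no _  = x

swapTab : ℕ → Tab → Tab
swapTab m = map (map (swapVal m))

-- action of π_m on a single tableau: nothing means 0
πTab : ℕ → Tab → Maybe Tab
πTab m T with pos T m | pos T (suc m)
... | just p@(r₁ , c₁) | just q@(r₂ , c₂) with c₁ ≤? c₂
...   | no _  = just T
...   | yes _ with attacks? p q
...     | yes _ = nothing
...     | no _  = just (swapTab m T)
πTab m T | _ | _ = just T

module Lin {c ℓ : Level} (R : CommutativeRing c ℓ) where
  open CommutativeRing R

  -- Σ a_T T represented as a finite list of (a_T , T)
  Comb : Set c
  Comb = List (Carrier × Tab)

  tabEq : (S T : Tab) → Dec (S ≡ T)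
  tabEq = LP.≡-dec (LP.≡-dec _≟ℕ_)

  coeff : Comb → Tab → Carrier
  coeff []            T = 0#
  coeff ((a , S) ∷ x) T with tabEq S T
  ... | yes _ = a + coeff x T
  ... | no  _ = coeff x T

  _≋_ : Comb → Comb → Set ℓ
  x ≋ y = ∀ T → coeff x T ≈ coeff y T

  single : Tab → Comb
  single T = (1# , T) ∷ []

  scale : Carrier → Comb → Comb
  scale a = map (λ { (b , T) → (a * b , T) })

  πC : ℕ → Comb → Comb
  πC m = concatMap (λ { (a , T) → act a (πTab m T) })
    where
      act : Carrier → Maybe Tab → Comb
      act a nothing  = []
      act a (just S) = (a , S) ∷ []

  -- elements of S_{α,E}, E being the class of T₀
  InE : ℕ → List ℕ → Tab → Tab → Set
  InE n α T₀ T = SCT n α T × T ∼ T₀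

  InSpan : ℕ → List ℕ → Tab → Comb → Set c
  InSpan n α T₀ x = All (λ p → InE n α T₀ (Data.Product.proj₂ p)) x

  record IsEndo (n : ℕ) (α : List ℕ) (T₀ : Tab) (f : Comb → Comb) : Set (c ⊔ ℓ) where
    field
      closed  : ∀ x → InSpan n α T₀ x → InSpan n α T₀ (f x)
      respect : ∀ x y → InSpan n α T₀ x → InSpan n α T₀ y → x ≋ y → f x ≋ f y
      additive : ∀ x y → InSpan n α T₀ x → InSpan n α T₀ y → f (x ++ y) ≋ (f x ++ f y)
      homog   : ∀ a x → InSpan n α T₀ x → f (scale a x) ≋ scale a (f x)
      commute : ∀ m → 1 ≤ m → m < n → ∀ x → InSpan n α T₀ x → f (πC m x) ≋ πC m (f x)

-- If m ∉ D(T₀) then π_m fixes T₀, so f(T₀) = f(π_m T₀) = π_m f(T₀).  But no tableau is sent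
-- by π_m to a tableau T with m ∈ D(T): π_m fixes only tableaux without that descent, and a
-- swap produces the descent only when m and m+1 share a column, where they attack.  Hence the
-- coefficient of such a T in π_m f(T₀) = f(T₀) vanishes.
module Submission where

open import Defs
open import Level using (Level)
open import Data.Nat using (ℕ; zero; suc; _≤_; _≤?_)
open import Data.Nat.Properties using (≤-antisym; 1+n≢n) renaming (_≟_ to _≟ℕ_)
open import Data.List using (List; []; _∷_; map)
open import Data.List.Relation.Unary.All using ([]; _∷_)
open import Data.Product using (∃-syntax; _×_; _,_)
open import Data.Sum using (_⊎_; inj₁; inj₂)
open import Data.Maybe using (just; nothing)
import Data.Maybe as Maybe
open import Data.Maybe.Properties using (just-injective)
open import Data.Empty using (⊥; ⊥-elim)
open import Function using (id; case_of_)
open import Relation.Nullary using (¬_; Dec; yes; no)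
open import Relation.Binary.PropositionalEquality using (_≡_; refl; sym; trans; cong)
open import Algebra.Bundles using (CommutativeRing)
import Relation.Binary.Reasoning.Setoid as SetoidReasoning

findInRow⇒at : ∀ row k c → findInRow row k ≡ just c → at row c ≡ just k
findInRow⇒at (x ∷ xs) k c eq with x ≟ℕ k
findInRow⇒at (x ∷ xs) k .zero refl | yes refl = refl
... | no _ with findInRow xs k in found
findInRow⇒at (x ∷ xs) k .(suc c) refl | no _ | just c = findInRow⇒at xs k c found

pos⇒entry : ∀ S k r c → pos S k ≡ just (r , c) → entry S r c ≡ just k
pos⇒entry (row ∷ rows) k r c eq with findInRow row k in found
pos⇒entry (row ∷ rows) k .zero c refl | just c = findInRow⇒at row k c found
... | nothing with pos rows k in found′
pos⇒entry (row ∷ rows) k .(suc r) c refl | nothing | just (r , .c) = pos⇒entry rows k r c found′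

pos-injective : ∀ S a b p → pos S a ≡ just p → pos S b ≡ just p → a ≡ b
pos-injective S a b (r , c) pa pb =
  just-injective (trans (sym (pos⇒entry S a r c pa)) (pos⇒entry S b r c pb))

swapVal-m : ∀ m → swapVal m m ≡ suc m
swapVal-m m with m ≟ℕ m
... | yes _ = refl
... | no m≢m = ⊥-elim (m≢m refl)

swapVal-suc : ∀ m → swapVal m (suc m) ≡ m
swapVal-suc m with suc m ≟ℕ m
... | yes 1+m≡m = ⊥-elim (1+n≢n 1+m≡m)
... | no _ with suc m ≟ℕ suc m
...   | yes _ = refl
...   | no ne = ⊥-elim (ne refl)

swapVal-other : ∀ m x → ¬ x ≡ m → ¬ x ≡ suc m → swapVal m x ≡ x
swapVal-other m x x≢m x≢1+m with x ≟ℕ m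
... | yes x≡m = ⊥-elim (x≢m x≡m)
... | no _ with x ≟ℕ suc m
...   | yes x≡1+m = ⊥-elim (x≢1+m x≡1+m)
...   | no _ = refl

swapVal-involutive : ∀ m x → swapVal m (swapVal m x) ≡ x
swapVal-involutive m x = byCases (x ≟ℕ m) (x ≟ℕ suc m)
  where
    byCases : Dec (x ≡ m) → Dec (x ≡ suc m) → swapVal m (swapVal m x) ≡ x
    byCases (yes refl) _ = trans (cong (swapVal m) (swapVal-m m)) (swapVal-suc m)
    byCases (no _) (yes refl) = trans (cong (swapVal m) (swapVal-suc m)) (swapVal-m m)
    byCases (no x≢m) (no x≢1+m) =
      trans (cong (swapVal m) (swapVal-other m x x≢m x≢1+m)) (swapVal-other m x x≢m x≢1+m)

findInRow-swap : ∀ m row k → findInRow (map (swapVal m) row) k ≡ findInRow row (swapVal m k)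
findInRow-swap m [] k = refl
findInRow-swap m (x ∷ xs) k with swapVal m x ≟ℕ k | x ≟ℕ swapVal m k
... | yes _ | yes _ = refl
... | no _ | no _ = cong (Maybe.map suc) (findInRow-swap m xs k)
... | yes refl | no ne = ⊥-elim (ne (sym (swapVal-involutive m x)))
... | no ne | yes refl = ⊥-elim (ne (swapVal-involutive m k))

pos-swapTab : ∀ m S k → pos (swapTab m S) k ≡ pos S (swapVal m k)
pos-swapTab m [] k = refl
pos-swapTab m (row ∷ rows) k rewrite findInRow-swap m row k with findInRow row (swapVal m k)
... | just c = refl
... | nothing = cong (Maybe.map _) (pos-swapTab m rows k)

∼-refl : ∀ T → T ∼ T
∼-refl T r r' c a b a' b' ra rb ra' rb'
  rewrite just-injective (trans (sym ra) ra') | just-injective (trans (sym rb) rb') = id , id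

ColumnDescent : ℕ → Tab → Set
ColumnDescent m T = ∃[ r₁ ] ∃[ c₁ ] ∃[ r₂ ] ∃[ c₂ ]
  (pos T m ≡ just (r₁ , c₁) × pos T (suc m) ≡ just (r₂ , c₂) × c₁ ≤ c₂)

ColumnDescent-columns : ∀ {m} T {r₁ c₁ r₂ c₂} → pos T m ≡ just (r₁ , c₁) → pos T (suc m) ≡ just (r₂ , c₂) →
  ColumnDescent m T → c₁ ≤ c₂
ColumnDescent-columns _ p₁ p₂ (_ , _ , _ , _ , q₁ , q₂ , c≤c)
  with trans (sym p₁) q₁ | trans (sym p₂) q₂
... | refl | refl = c≤c

πTab-fixed-or-descent : ∀ m S → πTab m S ≡ just S ⊎ ColumnDescent m S
πTab-fixed-or-descent m S with pos S m | pos S (suc m)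
... | just (r₁ , c₁) | just (r₂ , c₂) with c₁ ≤? c₂
...   | yes c₁≤c₂ = inj₂ (r₁ , c₁ , r₂ , c₂ , refl , refl , c₁≤c₂)
...   | no _ = inj₁ refl
πTab-fixed-or-descent m S | just _ | nothing = inj₁ refl
πTab-fixed-or-descent m S | nothing | _ = inj₁ refl

πTab-image-no-descent : ∀ m S T → πTab m S ≡ just T → ¬ ColumnDescent m T
πTab-image-no-descent m S T with pos S m in p₁ | pos S (suc m) in p₂
... | just (r₁ , c₁) | just (r₂ , c₂) with c₁ ≤? c₂
...   | no c₁≰c₂ = λ { refl d → c₁≰c₂ (ColumnDescent-columns S p₁ p₂ d) }
...   | yes c₁≤c₂ with attacks? (r₁ , c₁) (r₂ , c₂)
...     | yes _ = λ ()
...     | no ¬attack = λ { refl d →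
      ¬sameColumn (≤-antisym c₁≤c₂ (ColumnDescent-columns (swapTab m S) swapped-m swapped-suc d)) }
  where
    swapped-m : pos (swapTab m S) m ≡ just (r₂ , c₂)
    swapped-m = trans (pos-swapTab m S m) (trans (cong (pos S) (swapVal-m m)) p₂)
    swapped-suc : pos (swapTab m S) (suc m) ≡ just (r₁ , c₁)
    swapped-suc = trans (pos-swapTab m S (suc m)) (trans (cong (pos S) (swapVal-suc m)) p₁)
    ¬sameColumn : c₁ ≡ c₂ → ⊥
    ¬sameColumn refl with r₁ ≟ℕ r₂
    ... | no r₁≢r₂ = ¬attack (inj₁ (refl , r₁≢r₂))
    ... | yes refl = 1+n≢n (sym (pos-injective S m (suc m) (r₁ , c₁) p₁ p₂))
πTab-image-no-descent m S T | just _ | nothing =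
  λ { refl (_ , _ , _ , _ , _ , q₂ , _) → case trans (sym p₂) q₂ of λ () }
πTab-image-no-descent m S T | nothing | _ =
  λ { refl (_ , _ , _ , _ , q₁ , _) → case trans (sym p₁) q₁ of λ () }

module _ {c ℓ : Level} (R : CommutativeRing c ℓ) where
  open CommutativeRing R using (0#)
  open Lin R

  coeff-πC-descent : ∀ m T → ColumnDescent m T → ∀ y → coeff (πC m y) T ≡ 0#
  coeff-πC-descent m T d [] = refl
  coeff-πC-descent m T d ((a , S) ∷ y) with πTab m S in πS
  ... | nothing = coeff-πC-descent m T d y
  ... | just S′ with tabEq S′ T
  ...   | yes refl = ⊥-elim (πTab-image-no-descent m S S′ πS d)
  ...   | no _ = coeff-πC-descent m T d y

  πC-single-fixed : ∀ m S → πTab m S ≡ just S → πC m (single S) ≡ single S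
  πC-single-fixed m S fixed rewrite fixed = refl

lemma4p1 : {c ℓ : Level} (R : CommutativeRing c ℓ) →
    (n : ℕ) (α : List ℕ) → Composition n α →
    (T₀ : Tab) → SCT n α T₀ → IsSource n T₀ →
    (f : Lin.Comb R → Lin.Comb R) → Lin.IsEndo R n α T₀ f →
    (T : Tab) → Lin.InE R n α T₀ T →
    ¬ (CommutativeRing._≈_ R (Lin.coeff R (f (Lin.single R T₀)) T) (CommutativeRing.0# R)) →
    ∀ m → Des n T m → Des n T₀ m
lemma4p1 R n α _ T₀ T₀-sct _ f endo T _ coeff≉0 m (1≤m , m<n , T-descent)
  with πTab-fixed-or-descent m T₀
... | inj₂ T₀-descent = 1≤m , m<n , T₀-descent
... | inj₁ π-fixes = ⊥-elim (coeff≉0 (begin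
    coeff (f T₀′) T             ≡⟨ cong (λ x → coeff (f x) T) (πC-single-fixed R m T₀ π-fixes) ⟨
    coeff (f (πC m T₀′)) T      ≈⟨ Lin.IsEndo.commute endo m 1≤m m<n T₀′ T₀′∈span T ⟩
    coeff (πC m (f T₀′)) T      ≡⟨ coeff-πC-descent R m T T-descent (f T₀′) ⟩
    0#                          ∎))
  where
    open CommutativeRing R using (0#; setoid)
    open Lin R
    open SetoidReasoning setoid
    T₀′ : Comb
    T₀′ = single T₀
    T₀′∈span : InSpan n α T₀ T₀′
    T₀′∈span = (T₀-sct , ∼-refl T₀) ∷ []
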